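{- If $r\in\mathrm{Sd}(X\multimap Y)$ and $r'\in\mathrm{Sd}(Y\multimap Z)$ then $r'\cdot r\in\mathrm{Sd}(X\multimap Z)$.
   Context: An interface $X$ is $(|X|,P_X)$ with $P_X$ a monotonic predicate transformer on $\mathcal{P}(|X|)$; $\mathrm{Sd}(X)=\{x\mid x\subseteq P_X(x)\}$. Dual $X^\perp=(|X|,x\mapsto\overline{P_X(\overline{x})})$; tensor on $|X|\times|Y|$ with $r\mapsto\bigcup_{x\times y\subseteq r}P_X(x)\times P_Y(y)$; par $X\mathbin{\text{⅋}}Y=(X^\perp\otimes Y^\perp)^\perp$; $X\multimap Y=X^\perp\mathbin{\text{⅋}}Y$. For relations $r\subseteq A\times B$, $r'\subseteq B\times C$, $r'\cdot r=\{(a,c)\mid\exists b\,(a,b)\in r\wedge(b,c)\in r'\}$. -}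

module Defs where

open import Level using (Level; _⊔_; suc; 0ℓ)
open import Data.Product using (Σ; _×_; _,_; ∃)
open import Relation.Nullary using (¬_)
open import Relation.Unary using (Pred; _⊆_; _∈_)

Transformer : Set → (ℓ ℓ' : Level) → Set (suc (ℓ ⊔ ℓ'))
Transformer A ℓ ℓ' = Pred A ℓ → Pred A ℓ'

Monotone : ∀ {A ℓ ℓ'} → Transformer A ℓ ℓ' → Set (suc ℓ ⊔ ℓ')
Monotone P = ∀ {x y} → x ⊆ y → P x ⊆ P y

record Interface : Set₁ where
  field
    carrier : Set
    P       : Transformer carrier 0ℓ 0ℓ
    mono    : Monotone P
open Interface public

∁ : ∀ {A : Set} {ℓ} → Pred A ℓ → Pred A ℓ
∁ x a = ¬ x a

dualT : ∀ {A ℓ ℓ'} → Transformer A ℓ ℓ' → Transformer A ℓ ℓ'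
dualT P x = ∁ (P (∁ x))

_⊠_ : ∀ {A B : Set} {ℓ} → Pred A ℓ → Pred B ℓ → Pred (A × B) ℓ
(x ⊠ y) (a , b) = x a × y b

-- tensor transformer:  r ↦ ⋃_{x × y ⊆ r} P x × Q y
-- (the union over subsets x, y of level 0 raises the universe level by one)
tensorT : ∀ {A B : Set} → Transformer A 0ℓ 0ℓ → Transformer B 0ℓ 0ℓ
        → Transformer (A × B) 0ℓ (suc 0ℓ)
tensorT P Q r (a , b) =
  Σ (Pred _ 0ℓ) λ x → Σ (Pred _ 0ℓ) λ y → ((x ⊠ y) ⊆ r) × (P x a × Q y b)

parT : ∀ {A B : Set} → Transformer A 0ℓ 0ℓ → Transformer B 0ℓ 0ℓ
     → Transformer (A × B) 0ℓ (suc 0ℓ)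
parT P Q = dualT (tensorT (dualT P) (dualT Q))

lolliT : (X Y : Interface) → Transformer (carrier X × carrier Y) 0ℓ (suc 0ℓ)
lolliT X Y = parT (dualT (P X)) (P Y)

Sd : ∀ {A : Set} {ℓ'} → Transformer A 0ℓ ℓ' → Pred (Pred A 0ℓ) ℓ'
Sd P x = x ⊆ P x

_·_ : ∀ {A B C : Set} → Pred (B × C) 0ℓ → Pred (A × B) 0ℓ → Pred (A × C) 0ℓ
(r' · r) (a , c) = ∃ λ b → r (a , b) × r' (b , c)

-- Write x^⊥⊥ for the points of |X| lying in the bi-dual image of x.  Being a
-- safety relation for X ⊸ Y means: if (a , b) ∈ r and a ∈ x^⊥⊥, then b is in
-- (r[x])^⊥⊥, where r[x] is the direct image; this is the Sd condition applied
-- to the rectangle x × ∁ r[x], which is disjoint from r.  Composing, a point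
-- (a , c) of r' · r with a ∈ x^⊥⊥ goes through some b ∈ (r[x])^⊥⊥, and a
-- rectangle x × z disjoint from r' · r yields the rectangle r[x] × z disjoint
-- from r', so the Sd condition for r' excludes c from z^⊥.
module Submission where

open import Defs
open import Relation.Unary using (Pred; _⊆_)
open import Data.Product using (_×_; _,_; ∃)
open import Level using (0ℓ)

image : ∀ {A B : Set} → Pred (A × B) 0ℓ → Pred A 0ℓ → Pred B 0ℓ
image r x b = ∃ λ a → x a × r (a , b)

rectangle-∁image-disjoint : ∀ {A B : Set} (r : Pred (A × B) 0ℓ) (x : Pred A 0ℓ) →
  (x ⊠ ∁ (image r x)) ⊆ ∁ r
rectangle-∁image-disjoint r x {a , b} (xa , b∉rx) rab = b∉rx (a , xa , rab)

rectangle-image-disjoint : ∀ {A B C : Set}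
  (r : Pred (A × B) 0ℓ) (r' : Pred (B × C) 0ℓ) {x : Pred A 0ℓ} {z : Pred C 0ℓ} →
  (x ⊠ z) ⊆ ∁ (r' · r) → (image r x ⊠ z) ⊆ ∁ r'
rectangle-image-disjoint r r' x×z∩r'r=∅ {b , c} ((a , xa , rab) , zc) r'bc =
  x×z∩r'r=∅ (xa , zc) (b , rab , r'bc)

Sd-⊸-image : (X Y : Interface) (r : Pred (carrier X × carrier Y) 0ℓ) →
  Sd (lolliT X Y) r → ∀ {x a b} → r (a , b) →
  dualT (dualT (P X)) x a → dualT (dualT (P Y)) (image r x) b
Sd-⊸-image X Y r sd {x} rab a∈x⊥⊥ b∈∁rx⊥ =
  sd rab (x , ∁ (image r x) , rectangle-∁image-disjoint r x , a∈x⊥⊥ , b∈∁rx⊥)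

lemma7 : (X Y Z : Interface)
    (r : Pred (carrier X × carrier Y) 0ℓ) (r' : Pred (carrier Y × carrier Z) 0ℓ) →
    Sd (lolliT X Y) r → Sd (lolliT Y Z) r' → Sd (lolliT X Z) (r' · r)
lemma7 X Y Z r r' sd sd' (b , rab , r'bc) (x , z , x×z∩r'r=∅ , a∈x⊥⊥ , c∈z⊥) =
  sd' r'bc ( image r x , z , rectangle-image-disjoint r r' x×z∩r'r=∅
           , Sd-⊸-image X Y r sd rab a∈x⊥⊥ , c∈z⊥ )
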